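{- Let $Q_n$ denote the $n$-dimensional hypercube. Then $\zeta_h(Q_n)\leq 2^h(n-h)$ for every integer $h$ with $1\leq h\leq n-2$, and $\eta_h(Q_n)\leq 2^h(n-h)$ for every integer $h$ with $1\leq h\leq n-1$.
   Context: The hypercube $Q_n$ has as vertices the $2^n$ binary strings of length $n$, two vertices being adjacent iff they differ in exactly one position. $\zeta_h(Q_n)$ is the minimum cardinality of a set $F\subset V(Q_n)$ such that $Q_n-F$ is disconnected and every vertex of $Q_n-F$ is contained in a subgraph of $Q_n-F$ isomorphic to $Q_h$. $\eta_h(Q_n)$ is the minimum cardinality of a set $F\subset E(Q_n)$ such that $Q_n-F$ is disconnected and every vertex of $Q_n-F$ is contained in a subgraph of $Q_n-F$ isomorphic to $Q_h$. -}

module Defs where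

open import Data.Nat using (ℕ; zero; suc; _+_)
open import Data.Bool using (Bool; true; false; _≟_)
open import Data.Vec using (Vec; []; _∷_)
open import Data.List using (List)
open import Data.List.Membership.Propositional using (_∈_; _∉_)
open import Data.List.Relation.Unary.Unique.Propositional using (Unique)
open import Data.List.Relation.Unary.All using (All)
open import Data.List.Relation.Unary.AllPairs using (AllPairs)
open import Data.Product using (Σ; ∃; ∃-syntax; _×_; _,_; proj₁; proj₂)
open import Data.Sum using (_⊎_)
open import Data.Unit using (⊤)
open import Relation.Nullary using (¬_; yes; no)
open import Relation.Binary.PropositionalEquality using (_≡_)
open import Function.Definitions using (Injective)

Vertex : ℕ → Set
Vertex n = Vec Bool n

hamming : ∀ {n} → Vertex n → Vertex n → ℕ
hamming [] [] = zero
hamming (a ∷ u) (b ∷ v) with a ≟ b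
... | yes _ = hamming u v
... | no  _ = suc (hamming u v)

Adj : ∀ {n} → Vertex n → Vertex n → Set
Adj u v = hamming u v ≡ 1

-- A spanning-subgraph-style description of a subgraph of Q_n:
-- a predicate on surviving vertices and a predicate on surviving edges.
data Reach {n} (V : Vertex n → Set) (E : Vertex n → Vertex n → Set)
           (u : Vertex n) : Vertex n → Set where
  here : V u → Reach V E u u
  step : ∀ {v w} → Reach V E u v → Adj v w → E v w → V w → Reach V E u w

Disconnected : ∀ {n} → (Vertex n → Set) → (Vertex n → Vertex n → Set) → Set
Disconnected {n} V E =
  Σ (Vertex n) λ u → Σ (Vertex n) λ v → V u × V v × ¬ Reach V E u v

-- v lies in a subgraph isomorphic to Q_h: there is an injective map
-- φ : V(Q_h) → surviving vertices sending edges of Q_h to surviving edges,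
-- with v in its image.
InQh : ∀ {n} (h : ℕ) → (Vertex n → Set) → (Vertex n → Vertex n → Set) →
       Vertex n → Set
InQh {n} h V E v =
  Σ (Vertex h → Vertex n) λ φ →
    Injective _≡_ _≡_ φ
    × (∀ x → V (φ x))
    × (∀ x y → Adj x y → Adj (φ x) (φ y) × E (φ x) (φ y))
    × (∃[ x ] φ x ≡ v)

Good : ∀ {n} (h : ℕ) → (Vertex n → Set) → (Vertex n → Vertex n → Set) → Set
Good {n} h V E = Disconnected V E × (∀ v → V v → InQh h V E v)

VertexCut : ∀ {n} (h : ℕ) → List (Vertex n) → Set
VertexCut h F = Good h (λ x → x ∉ F) (λ _ _ → ⊤)

-- Edges are given by their two endpoints (ordered pair); an edge set is a
-- list of adjacent pairs in which no unordered edge occurs twice.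
SameEdge : ∀ {n} → Vertex n × Vertex n → Vertex n × Vertex n → Set
SameEdge (a , b) (c , d) = (a ≡ c × b ≡ d) ⊎ (a ≡ d × b ≡ c)

EdgeSet : ∀ {n} → List (Vertex n × Vertex n) → Set
EdgeSet F = All (λ e → Adj (proj₁ e) (proj₂ e)) F
          × AllPairs (λ e e' → ¬ SameEdge e e') F

EdgeIn : ∀ {n} → List (Vertex n × Vertex n) → Vertex n → Vertex n → Set
EdgeIn F x y = ∃[ e ] (e ∈ F × SameEdge e (x , y))

EdgeCut : ∀ {n} (h : ℕ) → List (Vertex n × Vertex n) → Set
EdgeCut h F = Good h (λ _ → ⊤) (λ x y → ¬ EdgeIn F x y)

module Submission where

-- Write n = h + k and split every vertex x of Q_n into its head (the first
-- h coordinates) and its tail (the last k).  The level of x is the number of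
-- ones in its tail.  The vertices sharing a tail form a copy of Q_h (a
-- "slice") lying inside one level, and adjacent vertices differ in level by
-- at most one.
--
--  * Vertex cut (k ≥ 2): delete the 2^h k vertices of level 1.  A path
--    starting at level 0 can then never leave level 0, so level 0 is
--    separated from level 2; every surviving vertex keeps its whole slice.
--  * Edge cut (k ≥ 1): delete the 2^h k edges joining a level-1 vertex to its
--    "foot" (same head, zero tail); these are exactly the edges between
--    levels 0 and 1.  Level 0 is separated from level 1, and slices, lying
--    inside one level, contain no deleted edge.

open import Defs
open import Data.Nat using (ℕ; _+_; _*_; _∸_; _^_; _≤_)
open import Data.List using (List; length)
open import Data.List.Relation.Unary.Unique.Propositional using (Unique)
open import Data.Product using (Σ; _×_)

open import Data.Nat using (zero; suc)
open import Data.Nat.Properties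
  using ( ≤-reflexive; ≤-trans; <⇒≤; ≤∧≢⇒<; n<1⇒n≡0; m≤n+m; m∸n≢0⇒n<m
        ; m≤o∸n⇒m+n≤o; m+[n∸m]≡n; m+n∸m≡n; +-assoc; +-identityʳ; *-assoc
        ; +-cancelʳ-≡; suc-injective; module ≤-Reasoning )
open import Data.Bool using (true; false; _≟_)
open import Data.Vec using (Vec; []; _∷_; _++_; replicate; take; drop)
open import Data.Vec.Properties using (take++drop≡id; ++-injectiveˡ; ++-injectiveʳ)
open import Data.List using ([]; _∷_; map) renaming (_++_ to _++ₗ_)
open import Data.List.Properties using (length-map; length-++)
open import Data.List.Membership.Propositional using (_∈_; _∉_)
open import Data.List.Membership.Propositional.Properties
  using (∈-map⁺; ∈-map⁻; ∈-++⁺ˡ; ∈-++⁺ʳ; ∈-++⁻)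
open import Data.List.Relation.Unary.Any using (here; there)
import Data.List.Relation.Unary.All as All
import Data.List.Relation.Unary.All.Properties as All
open import Data.List.Relation.Unary.AllPairs as AllPairs using ([]; _∷_)
import Data.List.Relation.Unary.AllPairs.Properties as AllPairs
import Data.List.Relation.Unary.Unique.Propositional.Properties as Unique
open import Data.Product using (_,_; ∃-syntax)
open import Data.Sum using (inj₁; inj₂)
open import Data.Unit using (⊤; tt)
open import Relation.Nullary using (¬_; yes; no; contradiction)
open import Relation.Binary.PropositionalEquality
  using (_≡_; _≢_; refl; sym; trans; cong; cong₂; subst; module ≡-Reasoning)

hamming≡0⇒≡ : ∀ {n} (x y : Vertex n) → hamming x y ≡ 0 → x ≡ y
hamming≡0⇒≡ []      []      _ = refl
hamming≡0⇒≡ (a ∷ x) (b ∷ y) d with a ≟ b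
hamming≡0⇒≡ (a ∷ x) (b ∷ y) d  | yes a≡b = cong₂ _∷_ a≡b (hamming≡0⇒≡ x y d)
hamming≡0⇒≡ (a ∷ x) (b ∷ y) () | no  _

hamming-self : ∀ {n} (x : Vertex n) → hamming x x ≡ 0
hamming-self []      = refl
hamming-self (a ∷ x) with a ≟ a
... | yes _   = hamming-self x
... | no  a≢a = contradiction refl a≢a

hamming-++ : ∀ {m n} (x y : Vertex m) (s t : Vertex n) →
             hamming (x ++ s) (y ++ t) ≡ hamming x y + hamming s t
hamming-++ []      []      s t = refl
hamming-++ (a ∷ x) (b ∷ y) s t with a ≟ b
... | yes _ = hamming-++ x y s t
... | no  _ = cong suc (hamming-++ x y s t)

take-++ : ∀ {A : Set} {m n} (x : Vec A m) (t : Vec A n) → take m (x ++ t) ≡ x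
take-++ {m = m} x t = ++-injectiveˡ (take m (x ++ t)) x (take++drop≡id m (x ++ t))

drop-++ : ∀ {A : Set} {m n} (x : Vec A m) (t : Vec A n) → drop m (x ++ t) ≡ t
drop-++ {m = m} x t = ++-injectiveʳ (take m (x ++ t)) x (take++drop≡id m (x ++ t))

hamming-split : ∀ h {k} (a b : Vertex (h + k)) →
  hamming a b ≡ hamming (take h a) (take h b) + hamming (drop h a) (drop h b)
hamming-split h a b =
  trans (cong₂ hamming (sym (take++drop≡id h a)) (sym (take++drop≡id h b)))
        (hamming-++ (take h a) (take h b) (drop h a) (drop h b))

zeros : ∀ {k} → Vertex k
zeros = replicate _ false

units : ∀ k → List (Vertex k)
units zero    = []
units (suc k) = (true ∷ zeros) ∷ map (false ∷_) (units k)

∈-units⁺ : ∀ {k} (s : Vertex k) → hamming zeros s ≡ 1 → s ∈ units k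
∈-units⁺ (true  ∷ s) w = here (cong (true ∷_) (sym (hamming≡0⇒≡ zeros s (suc-injective w))))
∈-units⁺ (false ∷ s) w = there (∈-map⁺ (false ∷_) (∈-units⁺ s w))

∈-units⁻ : ∀ {k} {s : Vertex k} → s ∈ units k → hamming zeros s ≡ 1
∈-units⁻ {suc k} (here refl) = cong suc (hamming-self (zeros {k}))
∈-units⁻ {suc k} (there p) with ∈-map⁻ (false ∷_) p
... | _ , q , refl = ∈-units⁻ q

units-unique : ∀ k → Unique (units k)
units-unique zero    = []
units-unique (suc k) =
  All.map⁺ (All.tabulate (λ _ ())) ∷ Unique.map⁺ (λ { refl → refl }) (units-unique k)

length-units : ∀ k → length (units k) ≡ k
length-units zero    = refl
length-units (suc k) = cong suc (trans (length-map _ (units k)) (length-units k))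

withPrefixes : ∀ h {k} → List (Vertex k) → List (Vertex (h + k))
withPrefixes zero    L = L
withPrefixes (suc h) L = map (true ∷_) (withPrefixes h L) ++ₗ map (false ∷_) (withPrefixes h L)

∈-withPrefixes⁺ : ∀ h {k} {L : List (Vertex k)} (x : Vertex (h + k)) →
                  drop h x ∈ L → x ∈ withPrefixes h L
∈-withPrefixes⁺ zero            x           p = p
∈-withPrefixes⁺ (suc h)         (true  ∷ x) p = ∈-++⁺ˡ (∈-map⁺ (true ∷_) (∈-withPrefixes⁺ h x p))
∈-withPrefixes⁺ (suc h) {L = L} (false ∷ x) p =
  ∈-++⁺ʳ (map (true ∷_) (withPrefixes h L)) (∈-map⁺ (false ∷_) (∈-withPrefixes⁺ h x p))

∈-withPrefixes⁻ : ∀ h {k} {L : List (Vertex k)} {x : Vertex (h + k)} →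
                  x ∈ withPrefixes h L → drop h x ∈ L
∈-withPrefixes⁻ zero    p = p
∈-withPrefixes⁻ (suc h) {L = L} p with ∈-++⁻ (map (true ∷_) (withPrefixes h L)) p
... | inj₁ q with ∈-map⁻ (true ∷_) q
...   | _ , r , refl = ∈-withPrefixes⁻ h r
∈-withPrefixes⁻ (suc h) p | inj₂ q with ∈-map⁻ (false ∷_) q
...   | _ , r , refl = ∈-withPrefixes⁻ h r

withPrefixes-unique : ∀ h {k} {L : List (Vertex k)} → Unique L → Unique (withPrefixes h L)
withPrefixes-unique zero    u = u
withPrefixes-unique (suc h) {L = L} u =
  Unique.++⁺ (Unique.map⁺ (λ { refl → refl }) W) (Unique.map⁺ (λ { refl → refl }) W) disjoint
  where
  W = withPrefixes-unique h u
  disjoint : ∀ {v} → ¬ (v ∈ map (true ∷_) (withPrefixes h L) × v ∈ map (false ∷_) (withPrefixes h L))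
  disjoint (p , q) with ∈-map⁻ (true ∷_) p | ∈-map⁻ (false ∷_) q
  ... | _ , _ , refl | _ , _ , ()

length-withPrefixes : ∀ h {k} (L : List (Vertex k)) →
                      length (withPrefixes h L) ≡ 2 ^ h * length L
length-withPrefixes zero    L = sym (+-identityʳ (length L))
length-withPrefixes (suc h) L = begin
  length (map (true ∷_) W ++ₗ map (false ∷_) W)
    ≡⟨ length-++ (map (true ∷_) W) ⟩
  length (map (true ∷_) W) + length (map (false ∷_) W)
    ≡⟨ cong₂ _+_ (length-map _ W) (length-map _ W) ⟩
  length W + length W
    ≡⟨ cong (λ l → l + l) (length-withPrefixes h L) ⟩
  2 ^ h * length L + 2 ^ h * length L
    ≡⟨ cong (2 ^ h * length L +_) (sym (+-identityʳ (2 ^ h * length L))) ⟩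
  2 * (2 ^ h * length L)
    ≡⟨ sym (*-assoc 2 (2 ^ h) (length L)) ⟩
  2 ^ suc h * length L ∎
  where
  open ≡-Reasoning
  W = withPrefixes h L

module Split (h k : ℕ) where

  Q : Set
  Q = Vertex (h + k)

  level : Q → ℕ
  level x = hamming zeros (drop h x)

  level≡0⇒tail-zero : ∀ (x : Q) → level x ≡ 0 → drop h x ≡ zeros
  level≡0⇒tail-zero x l = sym (hamming≡0⇒≡ zeros (drop h x) l)

  level-zeros-++ : ∀ (t : Vertex k) → level (zeros {h} ++ t) ≡ hamming zeros t
  level-zeros-++ t = cong (hamming zeros) (drop-++ (zeros {h}) t)

  level-0-neighbour : ∀ {a b : Q} → Adj a b → level a ≡ 0 → level b ≤ 1
  level-0-neighbour {a} {b} adj la = begin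
    hamming zeros (drop h b)
      ≡⟨ cong (λ z → hamming z (drop h b)) (sym (level≡0⇒tail-zero a la)) ⟩
    hamming (drop h a) (drop h b)
      ≤⟨ m≤n+m _ (hamming (take h a) (take h b)) ⟩
    hamming (take h a) (take h b) + hamming (drop h a) (drop h b)
      ≡⟨ sym (hamming-split h a b) ⟩
    hamming a b
      ≡⟨ adj ⟩
    1 ∎
    where open ≤-Reasoning

  confined-to-level-0 : ∀ {V : Q → Set} {E : Q → Q → Set} {u x : Q} →
    (∀ {a b} → Adj a b → E a b → V b → level a ≡ 0 → level b ≢ 1) →
    level u ≡ 0 → Reach V E u x → level x ≡ 0
  confined-to-level-0 blocked lu (here _) = lu
  confined-to-level-0 blocked lu (step r adj e vb) =
    n<1⇒n≡0 (≤∧≢⇒< (level-0-neighbour adj la) (blocked adj e vb la))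
    where la = confined-to-level-0 blocked lu r

  levelOne : List Q
  levelOne = withPrefixes h (units k)

  ∈-levelOne⁺ : ∀ (x : Q) → level x ≡ 1 → x ∈ levelOne
  ∈-levelOne⁺ x l = ∈-withPrefixes⁺ h x (∈-units⁺ (drop h x) l)

  ∈-levelOne⁻ : ∀ {x : Q} → x ∈ levelOne → level x ≡ 1
  ∈-levelOne⁻ p = ∈-units⁻ (∈-withPrefixes⁻ h p)

  levelOne-unique : Unique levelOne
  levelOne-unique = withPrefixes-unique h (units-unique k)

  length-levelOne : length levelOne ≡ 2 ^ h * k
  length-levelOne = trans (length-withPrefixes h (units k)) (cong (2 ^ h *_) (length-units k))

  slice : Q → Vertex h → Q
  slice y x = x ++ drop h y

  level-slice : ∀ (y : Q) (x : Vertex h) → level (slice y x) ≡ level y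
  level-slice y x = cong (hamming zeros) (drop-++ x (drop h y))

  slice-InQh : ∀ {V : Q → Set} {E : Q → Q → Set} (y : Q) →
    (∀ x → V (slice y x)) →
    (∀ x x' → Adj x x' → E (slice y x) (slice y x')) →
    InQh h V E y
  slice-InQh y survives edges-survive =
    slice y , (λ {x} {x'} → ++-injectiveˡ x x') , survives ,
    (λ x x' adj → adjacent x x' adj , edges-survive x x' adj) ,
    (take h y , take++drop≡id h y)
    where
    adjacent : ∀ x x' → Adj x x' → Adj (slice y x) (slice y x')
    adjacent x x' adj = trans (hamming-++ x x' (drop h y) (drop h y))
                              (cong₂ _+_ adj (hamming-self (drop h y)))

  foot : Q → Q
  foot x = take h x ++ zeros {k}

  foot-idempotent : ∀ (x : Q) → foot (foot x) ≡ foot x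
  foot-idempotent x = cong (_++ zeros) (take-++ (take h x) zeros)

  foot-level : ∀ (x : Q) → level (foot x) ≡ 0
  foot-level x = trans (cong (hamming zeros) (drop-++ (take h x) (zeros {k}))) (hamming-self (zeros {k}))

  foot-adjacent : ∀ (b : Q) → level b ≡ 1 → Adj (foot b) b
  foot-adjacent b lb = begin
    hamming (take h b ++ zeros) b
      ≡⟨ cong (hamming (take h b ++ zeros)) (sym (take++drop≡id h b)) ⟩
    hamming (take h b ++ zeros) (take h b ++ drop h b)
      ≡⟨ hamming-++ (take h b) (take h b) zeros (drop h b) ⟩
    hamming (take h b) (take h b) + level b
      ≡⟨ cong₂ _+_ (hamming-self (take h b)) lb ⟩
    1 ∎
    where open ≡-Reasoning

  level-0-1-edge : ∀ {a b : Q} → Adj a b → level a ≡ 0 → level b ≡ 1 → a ≡ foot b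
  level-0-1-edge {a} {b} adj la lb = begin
    a                       ≡⟨ sym (take++drop≡id h a) ⟩
    take h a ++ drop h a    ≡⟨ cong₂ _++_ same-head (level≡0⇒tail-zero a la) ⟩
    take h b ++ zeros       ∎
    where
    open ≡-Reasoning
    tail-distance : hamming (drop h a) (drop h b) ≡ 1
    tail-distance = trans (cong (λ z → hamming z (drop h b)) (level≡0⇒tail-zero a la)) lb
    same-head : take h a ≡ take h b
    same-head = hamming≡0⇒≡ _ _ (+-cancelʳ-≡ 1 _ 0
      (trans (cong (hamming (take h a) (take h b) +_) (sym tail-distance))
             (trans (sym (hamming-split h a b)) adj)))

  footEdges : List (Q × Q)
  footEdges = map (λ x → foot x , x) levelOne

  length-footEdges : length footEdges ≡ 2 ^ h * k
  length-footEdges = trans (length-map _ levelOne) length-levelOne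

  footEdges-edgeSet : EdgeSet footEdges
  footEdges-edgeSet =
    All.map⁺ (All.tabulate (λ {x} p → foot-adjacent x (∈-levelOne⁻ p))) ,
    AllPairs.map⁺ (AllPairs.map distinct levelOne-unique)
    where
    distinct : ∀ {x y} → x ≢ y → ¬ SameEdge (foot x , x) (foot y , y)
    distinct x≢y (inj₁ (_ , x≡y)) = x≢y x≡y
    distinct {x} {y} x≢y (inj₂ (fx≡y , x≡fy)) = x≢y (begin
      x                ≡⟨ x≡fy ⟩
      foot y           ≡⟨ sym (foot-idempotent y) ⟩
      foot (foot y)    ≡⟨ cong foot (sym x≡fy) ⟩
      foot x           ≡⟨ fx≡y ⟩
      y                ∎)
      where open ≡-Reasoning

  foot-level-differs : ∀ {z : Q} → z ∈ levelOne → level (foot z) ≢ level z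
  foot-level-differs {z} z∈ eq =
    contradiction (trans (sym (foot-level z)) (trans eq (∈-levelOne⁻ z∈))) λ ()

  footEdge-levels : ∀ {a b : Q} → EdgeIn footEdges a b → level a ≢ level b
  footEdge-levels (e , p , same) with ∈-map⁻ (λ x → foot x , x) p
  ... | z , z∈ , refl with same
  ...   | inj₁ (refl , refl) = foot-level-differs z∈
  ...   | inj₂ (refl , refl) = λ eq → foot-level-differs z∈ (sym eq)

  footEdge-between : ∀ {a b : Q} → Adj a b → level a ≡ 0 → level b ≡ 1 → EdgeIn footEdges a b
  footEdge-between {b = b} adj la lb =
    (foot b , b) , ∈-map⁺ (λ x → foot x , x) (∈-levelOne⁺ b lb) ,
    inj₁ (sym (level-0-1-edge adj la lb) , refl)

levelOne-vertexCut : ∀ h k → VertexCut h (Split.levelOne h (2 + k))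
levelOne-vertexCut h k = (u , v , u∉F , v∉F , separated) , inCopy
  where
  open Split h (2 + k)
  F = levelOne
  u v : Q
  u = zeros {h} ++ zeros
  v = zeros {h} ++ (true ∷ true ∷ zeros)
  level-u : level u ≡ 0
  level-u = trans (level-zeros-++ zeros) (hamming-self (zeros {2 + k}))
  level-v : level v ≡ 2
  level-v = trans (level-zeros-++ (true ∷ true ∷ zeros)) (cong (2 +_) (hamming-self (zeros {k})))
  u∉F : u ∉ F
  u∉F p = contradiction (trans (sym level-u) (∈-levelOne⁻ p)) λ ()
  v∉F : v ∉ F
  v∉F p = contradiction (trans (sym level-v) (∈-levelOne⁻ p)) λ ()
  separated : ¬ Reach (_∉ F) (λ _ _ → ⊤) u v
  separated r = contradiction
    (trans (sym level-v) (confined-to-level-0 (λ {_} {b} _ _ b∉F _ lb → b∉F (∈-levelOne⁺ b lb)) level-u r))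
    λ ()
  inCopy : ∀ y → y ∉ F → InQh h (_∉ F) (λ _ _ → ⊤) y
  inCopy y y∉F = slice-InQh {V = _∉ F} {E = λ _ _ → ⊤} y
    (λ x p → y∉F (∈-levelOne⁺ y (trans (sym (level-slice y x)) (∈-levelOne⁻ p))))
    (λ _ _ _ → tt)

footEdges-edgeCut : ∀ h k → EdgeCut h (Split.footEdges h (1 + k))
footEdges-edgeCut h k = (u , v , tt , tt , separated) , inCopy
  where
  open Split h (1 + k)
  Kept : Q → Q → Set
  Kept a b = ¬ EdgeIn footEdges a b
  u v : Q
  u = zeros {h} ++ zeros
  v = zeros {h} ++ (true ∷ zeros)
  level-u : level u ≡ 0
  level-u = trans (level-zeros-++ zeros) (hamming-self (zeros {1 + k}))
  level-v : level v ≡ 1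
  level-v = trans (level-zeros-++ (true ∷ zeros)) (cong suc (hamming-self (zeros {k})))
  separated : ¬ Reach (λ _ → ⊤) Kept u v
  separated r = contradiction
    (trans (sym level-v) (confined-to-level-0 (λ adj kept _ la lb → kept (footEdge-between adj la lb)) level-u r))
    λ ()
  inCopy : ∀ y → ⊤ → InQh h (λ _ → ⊤) Kept y
  inCopy y _ = slice-InQh {V = λ _ → ⊤} {E = Kept} y (λ _ → tt)
    (λ x x' _ cut → footEdge-levels cut (trans (level-slice y x) (sym (level-slice y x'))))

split-dimension : ∀ c n h → 1 ≤ h → h ≤ n ∸ c → ∃[ j ] n ≡ h + (c + j)
split-dimension c n h 1≤h h≤n∸c = n ∸ (h + c) , sym (begin
  h + (c + (n ∸ (h + c)))   ≡⟨ sym (+-assoc h c _) ⟩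
  h + c + (n ∸ (h + c))     ≡⟨ m+[n∸m]≡n (m≤o∸n⇒m+n≤o h c≤n h≤n∸c) ⟩
  n                         ∎)
  where
  open ≡-Reasoning
  c≤n : c ≤ n
  c≤n = <⇒≤ (m∸n≢0⇒n<m λ n∸c≡0 → contradiction (≤-trans 1≤h (subst (h ≤_) n∸c≡0 h≤n∸c)) λ ())

cut-size : ∀ h k {l} → l ≡ 2 ^ h * k → l ≤ 2 ^ h * (h + k ∸ h)
cut-size h k l≡ = ≤-reflexive (trans l≡ (cong (2 ^ h *_) (sym (m+n∸m≡n h k))))

smallVertexCut : ∀ n h → ∃[ j ] n ≡ h + (2 + j) →
  Σ (List (Vertex n)) λ F → Unique F × length F ≤ 2 ^ h * (n ∸ h) × VertexCut h F
smallVertexCut .(h + (2 + j)) h (j , refl) =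
  levelOne , levelOne-unique , cut-size h (2 + j) length-levelOne , levelOne-vertexCut h j
  where open Split h (2 + j)

smallEdgeCut : ∀ n h → ∃[ j ] n ≡ h + (1 + j) →
  Σ (List (Vertex n × Vertex n)) λ F → EdgeSet F × length F ≤ 2 ^ h * (n ∸ h) × EdgeCut h F
smallEdgeCut .(h + (1 + j)) h (j , refl) =
  footEdges , footEdges-edgeSet , cut-size h (1 + j) length-footEdges , footEdges-edgeCut h j
  where open Split h (1 + j)

lemma2p3 :
    ((n h : ℕ) → 1 ≤ h → h ≤ n ∸ 2 →
      Σ (List (Vertex n)) λ F →
        Unique F × length F ≤ 2 ^ h * (n ∸ h) × VertexCut h F)
    × ((n h : ℕ) → 1 ≤ h → h ≤ n ∸ 1 →
      Σ (List (Vertex n × Vertex n)) λ F →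
        EdgeSet F × length F ≤ 2 ^ h * (n ∸ h) × EdgeCut h F)
lemma2p3 =
  (λ n h 1≤h h≤n∸2 → smallVertexCut n h (split-dimension 2 n h 1≤h h≤n∸2)) ,
  (λ n h 1≤h h≤n∸1 → smallEdgeCut n h (split-dimension 1 n h 1≤h h≤n∸1))
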